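{- Define words $w_1=01$ and $w_i=w_{i-1}^2\big(\prod_{j=1}^{i-2}w_{i-1-j}\big)2$ for $i\ge2$. Then for all $i\geq1$, $|w_i|=F(2i+1)$, where $F$ is the Fibonacci sequence with $F(1)=F(2)=1$.
   Context: Products denote concatenation of words and $|u|$ is the length of the word $u$. -}

module Defs where

open import Data.Nat using (ℕ; zero; suc; _+_)
open import Data.Fin using (Fin; zero; suc)
open import Data.List using (List; []; _∷_; _++_)

Word : Set
Word = List (Fin 3)

-- w i  is the word w_i of the paper (i ≥ 1; w 0 is an unused dummy).
-- prod n = ∏_{j=1}^{n} w_{n+1-j} = w_n w_{n-1} ⋯ w_1  (concatenated in order j = 1..n),
-- so for i = n+2 the paper's ∏_{j=1}^{i-2} w_{i-1-j} is  prod n.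
mutual
  w : ℕ → Word
  w zero = []
  w (suc zero) = zero ∷ suc zero ∷ []
  w (suc (suc n)) = w (suc n) ++ w (suc n) ++ prod n ++ (suc (suc zero) ∷ [])

  prod : ℕ → Word
  prod zero = []
  prod (suc n) = w (suc n) ++ prod n

F : ℕ → ℕ
F zero = 0
F (suc zero) = 1
F (suc (suc n)) = F n + F (suc n)

-- Each w_{n+2} is two copies of w_{n+1} followed by the suffix p_n 2, where
-- p_n = w_n ⋯ w_1, and p_{n+1} 2 = w_{n+1} p_n 2. So the lengths a_n = |w_{n+1}|
-- and b_n = |p_n 2| satisfy a_{n+1} = a_n + (a_n + b_n) and b_{n+1} = a_n + b_n,
-- which is exactly how consecutive Fibonacci numbers F(2n+3), F(2n+2) advance.
module Submission where

open import Defs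
open import Data.Nat using (ℕ; zero; suc; _+_; _*_; _≤_)
open import Data.Nat.Properties using (+-assoc; +-comm; +-suc)
open import Data.Nat.Tactic.RingSolver using (solve-∀)
open import Data.List using (length; _++_)
open import Data.List.Properties using (length-++)
open import Relation.Binary.PropositionalEquality
  using (_≡_; refl; cong; cong₂; sym)
open Relation.Binary.PropositionalEquality.≡-Reasoning

length-w-suc-suc : ∀ n →
  length (w (suc (suc n))) ≡ length (w (suc n)) + (length (w (suc n)) + (length (prod n) + 1))
length-w-suc-suc n = begin
  length (w (suc n) ++ w (suc n) ++ prod n ++ _)
    ≡⟨ length-++ (w (suc n)) ⟩
  length (w (suc n)) + length (w (suc n) ++ prod n ++ _)
    ≡⟨ cong (length (w (suc n)) +_) (length-++ (w (suc n))) ⟩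
  length (w (suc n)) + (length (w (suc n)) + length (prod n ++ _))
    ≡⟨ cong (λ k → length (w (suc n)) + (length (w (suc n)) + k)) (length-++ (prod n)) ⟩
  length (w (suc n)) + (length (w (suc n)) + (length (prod n) + 1)) ∎

length-prod-suc : ∀ n →
  length (prod (suc n)) + 1 ≡ length (w (suc n)) + (length (prod n) + 1)
length-prod-suc n = begin
  length (w (suc n) ++ prod n) + 1
    ≡⟨ cong (_+ 1) (length-++ (w (suc n))) ⟩
  length (w (suc n)) + length (prod n) + 1
    ≡⟨ +-assoc (length (w (suc n))) (length (prod n)) 1 ⟩
  length (w (suc n)) + (length (prod n) + 1) ∎

double-suc : ∀ n → suc n + suc n ≡ suc (suc (n + n))
double-suc n = cong suc (+-suc n n)

twice-suc-plus-one : ∀ n → 3 + (n + n) ≡ 2 * suc n + 1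
twice-suc-plus-one = solve-∀

mutual
  length-w : ∀ n → length (w (suc n)) ≡ F (3 + (n + n))
  length-w zero = refl
  length-w (suc n) = begin
    length (w (suc (suc n)))
      ≡⟨ length-w-suc-suc n ⟩
    length (w (suc n)) + (length (w (suc n)) + (length (prod n) + 1))
      ≡⟨ cong₂ (λ a b → a + (a + b)) (length-w n) (length-prod n) ⟩
    F (3 + (n + n)) + (F (3 + (n + n)) + F (2 + (n + n)))
      ≡⟨ cong (F (3 + (n + n)) +_) (+-comm (F (3 + (n + n))) (F (2 + (n + n)))) ⟩
    F (5 + (n + n))
      ≡⟨ cong (λ m → F (3 + m)) (sym (double-suc n)) ⟩
    F (3 + (suc n + suc n)) ∎

  length-prod : ∀ n → length (prod n) + 1 ≡ F (2 + (n + n))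
  length-prod zero = refl
  length-prod (suc n) = begin
    length (prod (suc n)) + 1
      ≡⟨ length-prod-suc n ⟩
    length (w (suc n)) + (length (prod n) + 1)
      ≡⟨ cong₂ _+_ (length-w n) (length-prod n) ⟩
    F (3 + (n + n)) + F (2 + (n + n))
      ≡⟨ +-comm (F (3 + (n + n))) (F (2 + (n + n))) ⟩
    F (4 + (n + n))
      ≡⟨ cong (λ m → F (2 + m)) (sym (double-suc n)) ⟩
    F (2 + (suc n + suc n)) ∎

proposition5p6 : ∀ (i : ℕ) → 1 ≤ i → length (w i) ≡ F (2 * i + 1)
proposition5p6 (suc n) _ = begin
  length (w (suc n))    ≡⟨ length-w n ⟩
  F (3 + (n + n))       ≡⟨ cong F (twice-suc-plus-one n) ⟩
  F (2 * suc n + 1)     ∎
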